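{- Let $T$ be a plane labelled bipartite tree with $n$ white and $m$ black vertices, where $n+m$ is even, and let $T'$ be obtained from $T$ by an elementary movement. Then $T$ and $T'$ have different parity: $i(T')\neq i(T)$ (each invariant computed with any choice of white root vertex and root edge).
   Context: A plane labelled bipartite tree has white vertices labelled $v_1,\dots,v_n$ and black vertices labelled $u_1,\dots,u_m$ (distinct labels), adjacent vertices having different colours, embedded in the plane. Invariant: choose a white root vertex $v_i$ and a root edge $e$ incident to $v_i$. Traverse the boundary of $T$ counterclockwise starting at $v_i$, keeping $e$ to the left; write the label of a vertex when it is met for the first time and a closing bracket ")" when it is met for the last time, producing a string $c(T)$. Let $a$ = number of pairs of white labels $v_k,v_l$ with $v_k$ before $v_l$ in $c(T)$ and $k>l$; $b$ = the analogous number of inversions among black labels; $c$ = number of pairs (black label, white label) with the black label before the white one in $c(T)$; $d$ = number of pairs (closing bracket, label) with the bracket before the label; $e=|n-m|/2$. Set $i(T)\equiv a+b+c+\frac{d+e}{2}\pmod 2$; $T$ is even if $i(T)=0$ and odd if $i(T)=1$ (this does not depend on the choice of root vertex and root edge). A leaf is a vertex of degree one together with its edge. A movement: detach a black (resp. white) leaf $A$ from the white (resp. black) vertex $B$ to which it is attached, move $A$ along the boundary of the tree clockwise or counterclockwise to a white (resp. black) vertex $C$ (possibly $C=B$), and attach $A$ to $C$ at that position, keeping all labels. A movement of a black (resp. white) leaf is elementary if during it the leaf bypasses exactly one black (resp. white) vertex. -}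

module Defs where

open import Data.Nat using (ℕ; zero; suc; _+_; _<ᵇ_; ∣_-_∣)
open import Data.Nat.DivMod using (_/_; _%_)
open import Data.Fin using (Fin; toℕ)
open import Data.List using (List; []; _∷_; _++_; [_]; length; filter; allFin)
open import Data.Bool using (Bool; true; false; T)
open import Data.Product using (Σ; _×_; _,_)
open import Data.Sum using (_⊎_)
open import Relation.Binary.Construct.Closure.Equivalence using (EqClosure)
open import Data.List.Relation.Binary.Permutation.Propositional using (_↭_)
open import Relation.Nullary.Decidable using (T?)

-- A plane bipartite tree together with a choice of white root vertex and
-- root edge is represented as a rose tree: the root is a white vertex, and
-- the children of every vertex are listed in the order in which the
-- counterclockwise boundary traversal (started at the root, keeping the root
-- edge to the left) visits them.  For the root, the first child is the
-- other end of the root edge.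

data WT (n m : ℕ) : Set
data BT (n m : ℕ) : Set

data WT n m where
  wn : Fin n → List (BT n m) → WT n m

data BT n m where
  bn : Fin m → List (WT n m) → BT n m

whitesW : ∀ {n m} → WT n m → List (Fin n)
whitesBs : ∀ {n m} → List (BT n m) → List (Fin n)
whitesWs : ∀ {n m} → List (WT n m) → List (Fin n)
whitesW (wn l cs) = l ∷ whitesBs cs
whitesBs [] = []
whitesBs (bn _ ws ∷ bs) = whitesWs ws ++ whitesBs bs
whitesWs [] = []
whitesWs (w ∷ ws) = whitesW w ++ whitesWs ws

blacksW : ∀ {n m} → WT n m → List (Fin m)
blacksBs : ∀ {n m} → List (BT n m) → List (Fin m)
blacksWs : ∀ {n m} → List (WT n m) → List (Fin m)
blacksW (wn _ cs) = blacksBs cs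
blacksBs [] = []
blacksBs (bn l ws ∷ bs) = l ∷ blacksWs ws ++ blacksBs bs
blacksWs [] = []
blacksWs (w ∷ ws) = blacksW w ++ blacksWs ws

-- The labelling is a bijection: white labels are exactly v_1..v_n
-- (here 0..n-1) each once, black labels exactly u_1..u_m each once.
Labelled : ∀ {n m} → WT n m → Set
Labelled {n} {m} t = (whitesW t ↭ allFin n) × (blacksW t ↭ allFin m)

-- The code c(T): a label when a vertex is met for the first time and a
-- closing bracket when it is met for the last time.

data Tok (n m : ℕ) : Set where
  white : Fin n → Tok n m
  black : Fin m → Tok n m
  close : Tok n m

codeW : ∀ {n m} → WT n m → List (Tok n m)
codeBs : ∀ {n m} → List (BT n m) → List (Tok n m)
codeWs : ∀ {n m} → List (WT n m) → List (Tok n m)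
codeW (wn l cs) = white l ∷ codeBs cs ++ [ close ]
codeBs [] = []
codeBs (bn l ws ∷ bs) = (black l ∷ codeWs ws ++ [ close ]) ++ codeBs bs
codeWs [] = []
codeWs (w ∷ ws) = codeW w ++ codeWs ws

countPairs : ∀ {A : Set} → (A → A → Bool) → List A → ℕ
countPairs P [] = 0
countPairs P (x ∷ xs) = length (filter (λ y → T? (P x y)) xs) + countPairs P xs

invW : ∀ {n m} → Tok n m → Tok n m → Bool
invW (white k) (white l) = toℕ l <ᵇ toℕ k
invW _ _ = false

invB : ∀ {n m} → Tok n m → Tok n m → Bool
invB (black k) (black l) = toℕ l <ᵇ toℕ k
invB _ _ = false

bwPair : ∀ {n m} → Tok n m → Tok n m → Bool
bwPair (black _) (white _) = true
bwPair _ _ = false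

isLabel : ∀ {n m} → Tok n m → Bool
isLabel (white _) = true
isLabel (black _) = true
isLabel close = false

clPair : ∀ {n m} → Tok n m → Tok n m → Bool
clPair close y = isLabel y
clPair _ _ = false

-- i(T) = a + b + c + (d + e)/2  (mod 2),  e = |n - m| / 2.
-- (For n + m even, d + e is even, so the halvings are exact.)
parity : ∀ {n m} → WT n m → ℕ
parity {n} {m} t =
  let s = codeW t
      a = countPairs invW s
      b = countPairs invB s
      c = countPairs bwPair s
      d = countPairs clPair s
      e = ∣ n - m ∣ / 2
  in (a + b + c + (d + e) / 2) % 2

-- Both steps are
-- label-preserving isomorphisms of plane trees, and together they connect
-- all choices of white root vertex and root edge of a given plane tree.

data Reroot {n m : ℕ} : WT n m → WT n m → Set where
  -- take the next edge at the root as root edge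
  rotate : ∀ l c cs → Reroot (wn l (c ∷ cs)) (wn l (cs ++ [ c ]))
  -- move the root to the first white child w of the first black child b,
  -- with root edge w–b
  descend : ∀ lr lb lw cs ws rest →
    Reroot (wn lr (bn lb (wn lw cs ∷ ws) ∷ rest))
           (wn lw (bn lb (ws ++ [ wn lr rest ]) ∷ cs))

_≈ᵀ_ : ∀ {n m} → WT n m → WT n m → Set
_≈ᵀ_ = EqClosure Reroot

-- Elementary movements, in the counterclockwise direction, written at a
-- convenient root.

data ElemStep {n m : ℕ} : WT n m → WT n m → Set where
  -- black leaf A at white root r, next black vertex X (non-leaf) is
  -- bypassed, A is attached to the next white corner (at w)
  black-leaf : ∀ lr la lx lw cs ws rest →
    ElemStep (wn lr (bn la [] ∷ bn lx (wn lw cs ∷ ws) ∷ rest))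
             (wn lr (bn lx (wn lw (bn la [] ∷ cs) ∷ ws) ∷ rest))
  -- same, X a leaf: A returns to r (C = B), after X
  black-leaf-back : ∀ lr la lx rest →
    ElemStep (wn lr (bn la [] ∷ bn lx [] ∷ rest))
             (wn lr (bn lx [] ∷ bn la [] ∷ rest))
  -- white leaf A at black B, the white root w is bypassed, A is attached
  -- to the next black corner (at Y, the next neighbour of w)
  white-leaf : ∀ lw lb ws la ly ys rest →
    ElemStep (wn lw (bn lb (ws ++ [ wn la [] ]) ∷ bn ly ys ∷ rest))
             (wn lw (bn lb ws ∷ bn ly (wn la [] ∷ ys) ∷ rest))
  -- same, w a leaf: A returns to B (C = B), after w
  white-leaf-back : ∀ lw lb ws la →
    ElemStep (wn lw (bn lb (ws ++ [ wn la [] ]) ∷ []))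
             (wn lw (bn lb (wn la [] ∷ ws) ∷ []))

-- T' is obtained from T by an elementary movement (clockwise or
-- counterclockwise), T and T' given with arbitrary white roots/root edges
Elementary : ∀ {n m} → WT n m → WT n m → Set
Elementary {n} {m} t t' =
  Σ (WT n m) λ r → Σ (WT n m) λ r' →
    (t ≈ᵀ r) × (ElemStep r r' ⊎ ElemStep r' r) × (r' ≈ᵀ t')

module Submission where

-- i(T) is ⌊(2(a + b + c) + d + e) / 2⌋ modulo 2, so it is determined by 2(a + b + c) + d
-- modulo 4. A change of root or an elementary movement rearranges c(T) by transpositions of
-- adjacent blocks A and B, and such a transposition changes 2(a + b + c) + d by
-- 2|A||B| + c(B)|A| - c(A)|B| modulo 4, where |X| counts the labels and c(X) the closing
-- brackets in X. Codes of subtrees have as many brackets as labels; together with n + m being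
-- even this makes the total change 0 modulo 4 for a change of root and 2 for an elementary
-- movement, which flips i(T).

import Algebra.Solver.Monoid as MonoidSolver
open import Data.Bool using (Bool; true; false; _∧_; T)
open import Data.Empty using (⊥-elim)
open import Data.Fin using (Fin; toℕ)
open import Data.Fin.Properties using (toℕ-injective)
open import Data.List using (List; []; _∷_; _++_; [_]; length; filter; mapMaybe; allFin)
open import Data.List.Properties
  using (++-monoid; ++-assoc; ++-identityʳ; length-++; length-tabulate; filter-++; mapMaybe-++)
open import Data.List.Relation.Binary.Permutation.Propositional
  using (_↭_; ↭-refl; ↭-sym; ↭-trans; ↭⇒↭ₛ)
import Data.List.Relation.Binary.Permutation.Propositional.Properties as ↭
import Data.List.Relation.Binary.Permutation.Setoid.Properties as PermutationSetoid
open import Data.List.Relation.Unary.All using (All; []; _∷_)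
import Data.List.Relation.Unary.All as All
import Data.List.Relation.Unary.All.Properties as All
open import Data.List.Relation.Unary.AllPairs using (_∷_)
open import Data.List.Relation.Unary.Unique.Propositional using (Unique)
open import Data.List.Relation.Unary.Unique.Propositional.Properties using (allFin⁺)
open import Data.Maybe using (Maybe; just; nothing; maybe; is-just)
open import Data.Nat using (ℕ; zero; suc; _+_; _*_; _<_; s≤s; _<ᵇ_; ∣_-_∣)
open import Data.Nat.Divisibility using (_∣_; divides; ∣-refl; ∣1⇒≡1; ∣m+n∣m⇒∣n; m∣m*n; n∣m⇒m%n≡0)
open import Data.Nat.DivMod
  using (_%_; _/_; %-distribˡ-+; %-remove-+ʳ; m%n<n; m%[n*o]/o≡m/o%n; +-distrib-/-∣ʳ; m*n/n≡m)
open import Data.Nat.Properties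
  using (+-comm; +-assoc; +-identityʳ; +-suc; *-comm; *-identityʳ; *-zeroʳ; *-suc; *-distribʳ-+;
         +-commutativeSemigroup)
open import Algebra.Properties.CommutativeSemigroup +-commutativeSemigroup
  using () renaming (interchange to +-interchange)
open import Data.Nat.Tactic.RingSolver using (solve-∀)
open import Data.Product using (_×_; _,_; proj₁; proj₂)
open import Data.Sum using (_⊎_; inj₁; inj₂)
open import Function using (_∘_; _$_; id)
open import Level using (0ℓ)
open import Relation.Binary.Bundles using (Setoid)
open import Relation.Binary.Construct.Closure.ReflexiveTransitive using (ε; _◅_)
open import Relation.Binary.Construct.Closure.Symmetric using (fwd; bwd)
open import Relation.Binary.PropositionalEquality hiding ([_])
import Relation.Binary.Reasoning.Setoid as SetoidReasoning
open import Relation.Nullary using (¬_; contradiction)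
open import Relation.Nullary.Decidable using (T?)

open import Defs

-- Counting pairs in lists

indicator : Bool → ℕ
indicator true = 1
indicator false = 0

module _ {A : Set} where

  count : (A → Bool) → List A → ℕ
  count p xs = length (filter (λ x → T? (p x)) xs)

  count-∷ : ∀ p x xs → count p (x ∷ xs) ≡ indicator (p x) + count p xs
  count-∷ p x xs with p x
  ... | true  = refl
  ... | false = refl

  count-++ : ∀ p xs ys → count p (xs ++ ys) ≡ count p xs + count p ys
  count-++ p xs ys =
    trans (cong length (filter-++ (λ x → T? (p x)) xs ys)) (length-++ (filter _ xs))

  count-↭ : ∀ p {xs ys} → xs ↭ ys → count p xs ≡ count p ys
  count-↭ p xs↭ys = ↭.↭-length (↭.filter-↭ (λ x → T? (p x)) xs↭ys)

  count-cong : ∀ {p q} → (∀ x → p x ≡ q x) → ∀ xs → count p xs ≡ count q xs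
  count-cong p≗q [] = refl
  count-cong {p} {q} p≗q (x ∷ xs) = begin
    count p (x ∷ xs)              ≡⟨ count-∷ p x xs ⟩
    indicator (p x) + count p xs  ≡⟨ cong₂ _+_ (cong indicator (p≗q x)) (count-cong p≗q xs) ⟩
    indicator (q x) + count q xs  ≡⟨ count-∷ q x xs ⟨
    count q (x ∷ xs)              ∎
    where open ≡-Reasoning

  count-+ : ∀ {p q r} → (∀ x → indicator (r x) ≡ indicator (p x) + indicator (q x)) →
            ∀ xs → count r xs ≡ count p xs + count q xs
  count-+ r≗p+q [] = refl
  count-+ {p} {q} {r} r≗p+q (x ∷ xs) = begin
    count r (x ∷ xs)                                       ≡⟨ count-∷ r x xs ⟩
    indicator (r x) + count r xs                           ≡⟨ cong₂ _+_ (r≗p+q x) (count-+ r≗p+q xs) ⟩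
    (indicator (p x) + indicator (q x)) + (count p xs + count q xs)
      ≡⟨ +-interchange (indicator (p x)) (indicator (q x)) (count p xs) (count q xs) ⟩
    (indicator (p x) + count p xs) + (indicator (q x) + count q xs)
      ≡⟨ cong₂ _+_ (count-∷ p x xs) (count-∷ q x xs) ⟨
    count p (x ∷ xs) + count q (x ∷ xs)                    ∎
    where open ≡-Reasoning

  count-false : ∀ xs → count (λ _ → false) xs ≡ 0
  count-false [] = refl
  count-false (_ ∷ xs) = count-false xs

  count-∧ˡ : ∀ b q xs → count (λ x → b ∧ q x) xs ≡ indicator b * count q xs
  count-∧ˡ true  q xs = sym (+-identityʳ (count q xs))
  count-∧ˡ false q xs = count-false xs

  cross : (A → A → Bool) → List A → List A → ℕ
  cross P []       ys = 0
  cross P (x ∷ xs) ys = count (P x) ys + cross P xs ys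

  cross-++ʳ : ∀ P xs ys zs → cross P xs (ys ++ zs) ≡ cross P xs ys + cross P xs zs
  cross-++ʳ P []       ys zs = refl
  cross-++ʳ P (x ∷ xs) ys zs = begin
    count (P x) (ys ++ zs) + cross P xs (ys ++ zs)
      ≡⟨ cong₂ _+_ (count-++ (P x) ys zs) (cross-++ʳ P xs ys zs) ⟩
    (count (P x) ys + count (P x) zs) + (cross P xs ys + cross P xs zs)
      ≡⟨ +-interchange (count (P x) ys) (count (P x) zs) (cross P xs ys) (cross P xs zs) ⟩
    (count (P x) ys + cross P xs ys) + (count (P x) zs + cross P xs zs) ∎
    where open ≡-Reasoning

  cross-↭ʳ : ∀ P xs {ys zs} → ys ↭ zs → cross P xs ys ≡ cross P xs zs
  cross-↭ʳ P []       ys↭zs = refl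
  cross-↭ʳ P (x ∷ xs) ys↭zs = cong₂ _+_ (count-↭ (P x) ys↭zs) (cross-↭ʳ P xs ys↭zs)

  cross-[]ʳ : ∀ P xs → cross P xs [] ≡ 0
  cross-[]ʳ P []       = refl
  cross-[]ʳ P (_ ∷ xs) = cross-[]ʳ P xs

  cross-cong : ∀ {P R} → (∀ x y → P x y ≡ R x y) → ∀ xs ys → cross P xs ys ≡ cross R xs ys
  cross-cong P≗R []       ys = refl
  cross-cong P≗R (x ∷ xs) ys = cong₂ _+_ (count-cong (P≗R x) ys) (cross-cong P≗R xs ys)

  countPairs-++ : ∀ P xs ys →
                  countPairs P (xs ++ ys) ≡ countPairs P xs + countPairs P ys + cross P xs ys
  countPairs-++ P []       ys = sym (+-identityʳ (countPairs P ys))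
  countPairs-++ P (x ∷ xs) ys = begin
    count (P x) (xs ++ ys) + countPairs P (xs ++ ys)
      ≡⟨ cong₂ _+_ (count-++ (P x) xs ys) (countPairs-++ P xs ys) ⟩
    (count (P x) xs + count (P x) ys) + (countPairs P xs + countPairs P ys + cross P xs ys)
      ≡⟨ rearrange (count (P x) xs) (count (P x) ys) (countPairs P xs) (countPairs P ys) (cross P xs ys) ⟩
    (count (P x) xs + countPairs P xs) + countPairs P ys + (count (P x) ys + cross P xs ys) ∎
    where
    open ≡-Reasoning
    rearrange : ∀ a b c d e → (a + b) + (c + d + e) ≡ (a + c) + d + (b + e)
    rearrange = solve-∀

  countPairs-transpose : ∀ P L A B M →
    countPairs P (L ++ A ++ B ++ M) + cross P B A ≡ countPairs P (L ++ B ++ A ++ M) + cross P A B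
  countPairs-transpose P L A B M = begin
    #P (L ++ A ++ B ++ M) + ×P B A
      ≡⟨ cong (_+ ×P B A) (countPairs-++ P L (A ++ B ++ M)) ⟩
    #P L + #P (A ++ B ++ M) + ×P L (A ++ B ++ M) + ×P B A
      ≡⟨ cong₂ (λ u v → #P L + u + v + ×P B A) (expand A B) (cross-↭ʳ P L (↭.shifts A B)) ⟩
    #P L + (#P A + (#P B + #P M + ×P B M) + (×P A B + ×P A M)) + ×P L (B ++ A ++ M) + ×P B A
      ≡⟨ regroup (#P L) (#P A) (#P B) (#P M) (×P A B) (×P B A) (×P A M) (×P B M) (×P L (B ++ A ++ M)) ⟩
    #P L + (#P B + (#P A + #P M + ×P A M) + (×P B A + ×P B M)) + ×P L (B ++ A ++ M) + ×P A B
      ≡⟨ cong (λ u → #P L + u + ×P L (B ++ A ++ M) + ×P A B) (expand B A) ⟨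
    #P L + #P (B ++ A ++ M) + ×P L (B ++ A ++ M) + ×P A B
      ≡⟨ cong (_+ ×P A B) (countPairs-++ P L (B ++ A ++ M)) ⟨
    #P (L ++ B ++ A ++ M) + ×P A B ∎
    where
    open ≡-Reasoning
    #P = countPairs P
    ×P = cross P
    expand : ∀ X Y → #P (X ++ Y ++ M) ≡ #P X + (#P Y + #P M + ×P Y M) + (×P X Y + ×P X M)
    expand X Y = begin
      #P (X ++ Y ++ M)
        ≡⟨ countPairs-++ P X (Y ++ M) ⟩
      #P X + #P (Y ++ M) + ×P X (Y ++ M)
        ≡⟨ cong₂ (λ u v → #P X + u + v) (countPairs-++ P Y M) (cross-++ʳ P X Y M) ⟩
      #P X + (#P Y + #P M + ×P Y M) + (×P X Y + ×P X M) ∎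
    regroup : ∀ l a b m ab ba am bm r →
      l + (a + (b + m + bm) + (ab + am)) + r + ba ≡ l + (b + (a + m + am) + (ba + bm)) + r + ab
    regroup = solve-∀

  cross-product : ∀ {P} p q → (∀ x y → P x y ≡ p x ∧ q y) →
                  ∀ xs ys → cross P xs ys ≡ count p xs * count q ys
  cross-product p q P≗p∧q []       ys = refl
  cross-product {P} p q P≗p∧q (x ∷ xs) ys = begin
    count (P x) ys + cross P xs ys
      ≡⟨ cong₂ _+_ (count-cong (P≗p∧q x) ys) (cross-product p q P≗p∧q xs ys) ⟩
    count (λ y → p x ∧ q y) ys + count p xs * count q ys
      ≡⟨ cong (_+ count p xs * count q ys) (count-∧ˡ (p x) q ys) ⟩
    indicator (p x) * count q ys + count p xs * count q ys
      ≡⟨ *-distribʳ-+ (count q ys) (indicator (p x)) (count p xs) ⟨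
    (indicator (p x) + count p xs) * count q ys
      ≡⟨ cong (_* count q ys) (count-∷ p x xs) ⟨
    count p (x ∷ xs) * count q ys ∎
    where open ≡-Reasoning

  cross-tournament : ∀ P xs ys →
    All (λ x → All (λ y → indicator (P x y) + indicator (P y x) ≡ 1) ys) xs →
    cross P xs ys + cross P ys xs ≡ length xs * length ys
  cross-tournament P []       ys []               = cross-[]ʳ P ys
  cross-tournament P (x ∷ xs) ys (x-vs-ys ∷ rest) = begin
    count (P x) ys + cross P xs ys + cross P ys ([ x ] ++ xs)
      ≡⟨ cong (count (P x) ys + cross P xs ys +_) (cross-++ʳ P ys [ x ] xs) ⟩
    count (P x) ys + cross P xs ys + (cross P ys [ x ] + cross P ys xs)
      ≡⟨ +-interchange (count (P x) ys) (cross P xs ys) (cross P ys [ x ]) (cross P ys xs) ⟩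
    (count (P x) ys + cross P ys [ x ]) + (cross P xs ys + cross P ys xs)
      ≡⟨ cong₂ _+_ (beats x ys x-vs-ys) (cross-tournament P xs ys rest) ⟩
    length ys + length xs * length ys ∎
    where
    open ≡-Reasoning
    beats : ∀ x ys → All (λ y → indicator (P x y) + indicator (P y x) ≡ 1) ys →
            count (P x) ys + cross P ys [ x ] ≡ length ys
    beats x []       []          = refl
    beats x (y ∷ ys) (xy ∷ x-ys) = begin
      count (P x) (y ∷ ys) + (count (P y) [ x ] + cross P ys [ x ])
        ≡⟨ cong₂ (λ u v → u + (v + cross P ys [ x ])) (count-∷ (P x) y ys) (count-∷ (P y) x []) ⟩
      indicator (P x y) + count (P x) ys + (indicator (P y x) + 0 + cross P ys [ x ])
        ≡⟨ rearrange (indicator (P x y)) (count (P x) ys) (indicator (P y x)) (cross P ys [ x ]) ⟩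
      (indicator (P x y) + indicator (P y x)) + (count (P x) ys + cross P ys [ x ])
        ≡⟨ cong₂ _+_ xy (beats x ys x-ys) ⟩
      suc (length ys) ∎
      where
      rearrange : ∀ a b c d → a + b + (c + 0 + d) ≡ (a + c) + (b + d)
      rearrange = solve-∀

module _ {X : Set} where

  Unique-++⁻ : ∀ xs {ys : List X} → Unique (xs ++ ys) →
               All (λ x → All (x ≢_) ys) xs × Unique ys
  Unique-++⁻ []       unique            = [] , unique
  Unique-++⁻ (x ∷ xs) (x∉xs++ys ∷ unique) =
    let disjoint , unique-ys = Unique-++⁻ xs unique
    in All.++⁻ʳ xs x∉xs++ys ∷ disjoint , unique-ys

  Unique-middle-disjoint : ∀ L A B M → Unique (L ++ A ++ B ++ M) → All (λ x → All (x ≢_) B) A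
  Unique-middle-disjoint L A B M unique =
    All.map (All.++⁻ˡ B) (proj₁ (Unique-++⁻ A (proj₂ (Unique-++⁻ L unique))))

  Unique-resp-↭ : ∀ {xs ys : List X} → xs ↭ ys → Unique xs → Unique ys
  Unique-resp-↭ xs↭ys = PermutationSetoid.Unique-resp-↭ (setoid X) (↭⇒↭ₛ xs↭ys)

module _ {A K : Set} (key : A → Maybe K) where

  viaKey : (K → K → Bool) → A → A → Bool
  viaKey R x y = maybe (λ k → maybe (R k) false (key y)) false (key x)

  length-mapMaybe : ∀ xs → length (mapMaybe key xs) ≡ count (λ x → is-just (key x)) xs
  length-mapMaybe []       = refl
  length-mapMaybe (x ∷ xs) with key x
  ... | just _  = cong suc (length-mapMaybe xs)
  ... | nothing = length-mapMaybe xs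

  count-mapMaybe : ∀ p ys → count p (mapMaybe key ys) ≡ count (λ y → maybe p false (key y)) ys
  count-mapMaybe p []       = refl
  count-mapMaybe p (y ∷ ys) = begin
    count p (mapMaybe key (y ∷ ys))                         ≡⟨ count-head ⟩
    indicator (maybe p false (key y)) + count p (mapMaybe key ys)
      ≡⟨ cong (indicator (maybe p false (key y)) +_) (count-mapMaybe p ys) ⟩
    indicator (maybe p false (key y)) + count (λ y → maybe p false (key y)) ys
      ≡⟨ count-∷ (λ y → maybe p false (key y)) y ys ⟨
    count (λ y → maybe p false (key y)) (y ∷ ys)            ∎
    where
    open ≡-Reasoning
    count-head : count p (mapMaybe key (y ∷ ys)) ≡
                 indicator (maybe p false (key y)) + count p (mapMaybe key ys)
    count-head with key y
    ... | nothing = refl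
    ... | just l  = count-∷ p l (mapMaybe key ys)

  mapMaybe-middle-disjoint : ∀ L A B M → Unique (mapMaybe key (L ++ A ++ B ++ M)) →
    All (λ i → All (i ≢_) (mapMaybe key B)) (mapMaybe key A)
  mapMaybe-middle-disjoint L A B M unique =
    Unique-middle-disjoint (mapMaybe key L) (mapMaybe key A) (mapMaybe key B) (mapMaybe key M)
      (subst Unique (trans (mapMaybe-++ key L _) (cong (mapMaybe key L ++_)
        (trans (mapMaybe-++ key A _) (cong (mapMaybe key A ++_) (mapMaybe-++ key B M))))) unique)

  cross-viaKey : ∀ R xs ys → cross (viaKey R) xs ys ≡ cross R (mapMaybe key xs) (mapMaybe key ys)
  cross-viaKey R []       ys = refl
  cross-viaKey R (x ∷ xs) ys with key x
  ... | just k  = cong₂ _+_ (sym (count-mapMaybe (R k) ys)) (cross-viaKey R xs ys)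
  ... | nothing = trans (cong (_+ cross (viaKey R) xs ys) (count-false ys)) (cross-viaKey R xs ys)

<ᵇ-tournament : ∀ i j → i ≢ j → indicator (j <ᵇ i) + indicator (i <ᵇ j) ≡ 1
<ᵇ-tournament zero    zero    i≢j = ⊥-elim (i≢j refl)
<ᵇ-tournament zero    (suc j) i≢j = refl
<ᵇ-tournament (suc i) zero    i≢j = refl
<ᵇ-tournament (suc i) (suc j) i≢j = <ᵇ-tournament i j (i≢j ∘ cong suc)

_>ᶠ_ : ∀ {k} → Fin k → Fin k → Bool
i >ᶠ j = toℕ j <ᵇ toℕ i

inversions-cross : ∀ {A : Set} {k} (key : A → Maybe (Fin k)) xs ys →
  All (λ i → All (i ≢_) (mapMaybe key ys)) (mapMaybe key xs) →
  cross (viaKey key _>ᶠ_) xs ys + cross (viaKey key _>ᶠ_) ys xs ≡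
  length (mapMaybe key xs) * length (mapMaybe key ys)
inversions-cross key xs ys disjoint = begin
  cross (viaKey key _>ᶠ_) xs ys + cross (viaKey key _>ᶠ_) ys xs
    ≡⟨ cong₂ _+_ (cross-viaKey key _>ᶠ_ xs ys) (cross-viaKey key _>ᶠ_ ys xs) ⟩
  cross _>ᶠ_ (mapMaybe key xs) (mapMaybe key ys) + cross _>ᶠ_ (mapMaybe key ys) (mapMaybe key xs)
    ≡⟨ cross-tournament _>ᶠ_ (mapMaybe key xs) (mapMaybe key ys)
         (All.map (All.map λ {j} i≢j → <ᵇ-tournament _ (toℕ j) (i≢j ∘ toℕ-injective)) disjoint) ⟩
  length (mapMaybe key xs) * length (mapMaybe key ys) ∎
  where open ≡-Reasoning

-- Congruence modulo 4

infix 4 _≡₄_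
record _≡₄_ (x y : ℕ) : Set where
  constructor mod4
  field residue-eq : x % 4 ≡ y % 4

≡₄-sym : ∀ {x y} → x ≡₄ y → y ≡₄ x
≡₄-sym (mod4 eq) = mod4 (sym eq)

≡₄-trans : ∀ {x y z} → x ≡₄ y → y ≡₄ z → x ≡₄ z
≡₄-trans (mod4 eq) (mod4 eq′) = mod4 (trans eq eq′)

≡₄-setoid : Setoid 0ℓ 0ℓ
≡₄-setoid = record
  { Carrier       = ℕ
  ; _≈_           = _≡₄_
  ; isEquivalence = record { refl = mod4 refl ; sym = ≡₄-sym ; trans = ≡₄-trans }
  }

module ≡₄-Reasoning = SetoidReasoning ≡₄-setoid

+-cong₄ : ∀ {x y u v} → x ≡₄ y → u ≡₄ v → x + u ≡₄ y + v
+-cong₄ {x} {y} {u} {v} (mod4 x≡y) (mod4 u≡v) = mod4 $ begin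
  (x + u) % 4          ≡⟨ %-distribˡ-+ x u 4 ⟩
  (x % 4 + u % 4) % 4  ≡⟨ cong₂ (λ a b → (a + b) % 4) x≡y u≡v ⟩
  (y % 4 + v % 4) % 4  ≡⟨ %-distribˡ-+ y v 4 ⟨
  (y + v) % 4          ∎
  where open ≡-Reasoning

+-congʳ₄ : ∀ z {x y} → x ≡₄ y → x + z ≡₄ y + z
+-congʳ₄ z x≡y = +-cong₄ x≡y (mod4 refl)

+-absorbʳ₄ : ∀ x {d} → 4 ∣ d → x + d ≡₄ x
+-absorbʳ₄ x 4∣d = mod4 (%-remove-+ʳ x 4∣d)

+-cancelʳ₄ : ∀ z {x y} → x + z ≡₄ y + z → x ≡₄ y
+-cancelʳ₄ zero    {x} {y} eq = subst₂ _≡₄_ (+-identityʳ x) (+-identityʳ y) eq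
+-cancelʳ₄ (suc z) {x} {y} eq =
  suc-cancel₄ (+-cancelʳ₄ z (subst₂ _≡₄_ (+-suc x z) (+-suc y z) eq))
  where
  open ≡₄-Reasoning
  suc-cancel₄ : ∀ {x y} → suc x ≡₄ suc y → x ≡₄ y
  suc-cancel₄ {x} {y} eq = begin
    x            ≈⟨ +-absorbʳ₄ x (∣-refl {4}) ⟨
    x + 4        ≡⟨ +-suc x 3 ⟩
    suc x + 3    ≈⟨ +-congʳ₄ 3 eq ⟩
    suc y + 3    ≡⟨ +-suc y 3 ⟨
    y + 4        ≈⟨ +-absorbʳ₄ y (∣-refl {4}) ⟩
    y            ∎

+2*-swap₄ : ∀ {x y} k → x ≡₄ y + 2 * k → x + 2 * k ≡₄ y
+2*-swap₄ {x} {y} k eq = begin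
  x + 2 * k            ≈⟨ +-congʳ₄ (2 * k) eq ⟩
  y + 2 * k + 2 * k    ≡⟨ +-assoc y (2 * k) (2 * k) ⟩
  y + (2 * k + 2 * k)  ≈⟨ +-absorbʳ₄ y (divides k (four-k k)) ⟩
  y                    ∎
  where
  open ≡₄-Reasoning
  four-k : ∀ k → 2 * k + 2 * k ≡ k * 4
  four-k = solve-∀

m+2≡₄n⇒m%4/2≢n%4/2 : ∀ m n → m + 2 ≡₄ n → m % 4 / 2 ≢ n % 4 / 2
m+2≡₄n⇒m%4/2≢n%4/2 m n (mod4 m+2≡n) =
  subst (λ r → m % 4 / 2 ≢ r / 2) (trans (sym (%-distribˡ-+ m 2 4)) m+2≡n)
        (halves-differ (m % 4) (m%n<n m 4))
  where
  halves-differ : ∀ r → r < 4 → r / 2 ≢ (r + 2) % 4 / 2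
  halves-differ 0 _ ()
  halves-differ 1 _ ()
  halves-differ 2 _ ()
  halves-differ 3 _ ()
  halves-differ (suc (suc (suc (suc _)))) (s≤s (s≤s (s≤s (s≤s ()))))

data Parity : ℕ → Set where
  even : ∀ k → Parity (2 * k)
  odd  : ∀ k → Parity (1 + 2 * k)

parity-view : ∀ n → Parity n
parity-view zero    = even 0
parity-view (suc n) with parity-view n
... | even k = odd k
... | odd k  = subst Parity (*-suc 2 k) (even (suc k))

2∤1+2* : ∀ k → ¬ 2 ∣ 1 + 2 * k
2∤1+2* k 2∣odd = contradiction (∣1⇒≡1 2∣1) λ ()
  where
  2∣1 : 2 ∣ 1
  2∣1 = ∣m+n∣m⇒∣n (subst (2 ∣_) (+-comm 1 (2 * k)) 2∣odd) (m∣m*n k)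

4∣⇒≡₄0 : ∀ {d} → 4 ∣ d → d ≡₄ 0
4∣⇒≡₄0 {d} 4∣d = mod4 (n∣m⇒m%n≡0 d 4 4∣d)

2∣1+m+n⇒2*[m*n]≡₄0 : ∀ m n → 2 ∣ 1 + m + n → 2 * (m * n) ≡₄ 0
2∣1+m+n⇒2*[m*n]≡₄0 m n odd-sum with parity-view m | parity-view n
... | even k | _      = 4∣⇒≡₄0 (divides (k * n) (lemma k n))
  where
  lemma : ∀ k n → 2 * (2 * k * n) ≡ k * n * 4
  lemma = solve-∀
... | odd k  | even l = 4∣⇒≡₄0 (divides ((1 + 2 * k) * l) (lemma k l))
  where
  lemma : ∀ k l → 2 * ((1 + 2 * k) * (2 * l)) ≡ (1 + 2 * k) * l * 4
  lemma = solve-∀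
... | odd k  | odd l  = contradiction (subst (2 ∣_) (lemma k l) odd-sum) (2∤1+2* (1 + k + l))
  where
  lemma : ∀ k l → 1 + (1 + 2 * k) + (1 + 2 * l) ≡ 1 + 2 * (1 + k + l)
  lemma = solve-∀

2∣1+n⇒2*n≡₄2 : ∀ n → 2 ∣ 1 + n → 2 * n ≡₄ 2
2∣1+n⇒2*n≡₄2 n even-successor with parity-view n
... | even k = contradiction even-successor (2∤1+2* k)
... | odd k  = subst (_≡₄ 2) (sym (lemma k)) (+-absorbʳ₄ 2 (divides k refl))
  where
  lemma : ∀ k → 2 * (1 + 2 * k) ≡ 2 + k * 4
  lemma = solve-∀

-- Tokens and the doubled index

module _ {n m : ℕ} where

  whiteKey : Tok n m → Maybe (Fin n)
  whiteKey (white i) = just i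
  whiteKey _         = nothing

  blackKey : Tok n m → Maybe (Fin m)
  blackKey (black j) = just j
  blackKey _         = nothing

  isClose : Tok n m → Bool
  isClose close = true
  isClose _     = false

  whites : List (Tok n m) → List (Fin n)
  whites = mapMaybe whiteKey

  blacks : List (Tok n m) → List (Fin m)
  blacks = mapMaybe blackKey

  #labels #closes : List (Tok n m) → ℕ
  #labels = count isLabel
  #closes = count isClose

  whites-++ : ∀ s t → whites (s ++ t) ≡ whites s ++ whites t
  whites-++ = mapMaybe-++ whiteKey

  blacks-++ : ∀ s t → blacks (s ++ t) ≡ blacks s ++ blacks t
  blacks-++ = mapMaybe-++ blackKey

  whites-close : ∀ s → whites (s ++ [ close ]) ≡ whites s
  whites-close s = trans (whites-++ s [ close ]) (++-identityʳ (whites s))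

  blacks-close : ∀ s → blacks (s ++ [ close ]) ≡ blacks s
  blacks-close s = trans (blacks-++ s [ close ]) (++-identityʳ (blacks s))

  #labels-++ : ∀ s t → #labels (s ++ t) ≡ #labels s + #labels t
  #labels-++ = count-++ isLabel

  #labels-close : ∀ s → #labels (s ++ [ close ]) ≡ #labels s
  #labels-close s = trans (count-++ isLabel s [ close ]) (+-identityʳ (#labels s))

  invW-viaKey : ∀ x y → invW x y ≡ viaKey whiteKey _>ᶠ_ x y
  invW-viaKey (white _) (white _) = refl
  invW-viaKey (white _) (black _) = refl
  invW-viaKey (white _) close     = refl
  invW-viaKey (black _) _         = refl
  invW-viaKey close     _         = refl

  invB-viaKey : ∀ x y → invB x y ≡ viaKey blackKey _>ᶠ_ x y
  invB-viaKey (black _) (black _) = refl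
  invB-viaKey (black _) (white _) = refl
  invB-viaKey (black _) close     = refl
  invB-viaKey (white _) _         = refl
  invB-viaKey close     _         = refl

  bwPair-split : ∀ x y → bwPair x y ≡ is-just (blackKey x) ∧ is-just (whiteKey y)
  bwPair-split (black _) (white _) = refl
  bwPair-split (black _) (black _) = refl
  bwPair-split (black _) close     = refl
  bwPair-split (white _) _         = refl
  bwPair-split close     _         = refl

  clPair-split : ∀ x y → clPair x y ≡ isClose x ∧ isLabel y
  clPair-split close     _ = refl
  clPair-split (white _) _ = refl
  clPair-split (black _) _ = refl

  #labels≡#whites+#blacks : ∀ s → #labels s ≡ length (whites s) + length (blacks s)
  #labels≡#whites+#blacks s = begin
    count isLabel s
      ≡⟨ count-+ label-split s ⟩
    count (λ x → is-just (whiteKey x)) s + count (λ x → is-just (blackKey x)) s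
      ≡⟨ cong₂ _+_ (length-mapMaybe whiteKey s) (length-mapMaybe blackKey s) ⟨
    length (whites s) + length (blacks s) ∎
    where
    open ≡-Reasoning
    label-split : ∀ x → indicator (isLabel x) ≡
                        indicator (is-just (whiteKey x)) + indicator (is-just (blackKey x))
    label-split (white _) = refl
    label-split (black _) = refl
    label-split close     = refl

  record Admissible (s : List (Tok n m)) : Set where
    field
      whites-unique : Unique (whites s)
      blacks-unique : Unique (blacks s)
      labels-even   : 2 ∣ #labels s

  Admissible-↭ : ∀ {s t} → s ↭ t → Admissible s → Admissible t
  Admissible-↭ s↭t adm = record
    { whites-unique = Unique-resp-↭ (↭.mapMaybe-↭ whiteKey s↭t) whites-unique
    ; blacks-unique = Unique-resp-↭ (↭.mapMaybe-↭ blackKey s↭t) blacks-unique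
    ; labels-even   = subst (2 ∣_) (count-↭ isLabel s↭t) labels-even
    }
    where open Admissible adm

  weigh : ((Tok n m → Tok n m → Bool) → ℕ) → ℕ
  weigh f = 2 * (f invW + f invB + f bwPair) + f clPair

  doubledIndex : List (Tok n m) → ℕ
  doubledIndex s = weigh (λ P → countPairs P s)

  weigh-+ : ∀ f g → weigh f + weigh g ≡ weigh (λ P → f P + g P)
  weigh-+ f g = lemma (f invW) (f invB) (f bwPair) (f clPair) (g invW) (g invB) (g bwPair) (g clPair)
    where
    lemma : ∀ a b c d a′ b′ c′ d′ →
      2 * (a + b + c) + d + (2 * (a′ + b′ + c′) + d′) ≡ 2 * (a + a′ + (b + b′) + (c + c′)) + (d + d′)
    lemma = solve-∀

  weigh-cong : ∀ {f g} → (∀ P → f P ≡ g P) → weigh f ≡ weigh g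
  weigh-cong f≗g =
    cong₂ (λ a b → 2 * a + b) (cong₂ _+_ (cong₂ _+_ (f≗g invW) (f≗g invB)) (f≗g bwPair)) (f≗g clPair)

  -- The pairs inside L, inside M, or between L ∪ M and A ∪ B are unchanged; between A and B,
  -- the inversions of each colour are complemented, whereas each (black, white) pair and
  -- each (close, label) pair changes side.
  doubledIndex-transpose : ∀ L A B M → Admissible (L ++ A ++ B ++ M) →
    doubledIndex (L ++ B ++ A ++ M) + 2 * (#labels A * #labels B) + #closes A * #labels B ≡₄
    doubledIndex (L ++ A ++ B ++ M) + #closes B * #labels A
  doubledIndex-transpose L A B M adm =
    subst (_≡₄ Q s + cB * lA) (sym exact) (+-absorbʳ₄ (Q s + cB * lA) (divides K refl))
    where
    open Admissible adm
    Q = doubledIndex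
    s = L ++ A ++ B ++ M
    t = L ++ B ++ A ++ M
    X Y : (Tok n m → Tok n m → Bool) → ℕ
    X P = cross P A B
    Y P = cross P B A
    wA = length (whites A)
    wB = length (whites B)
    bA = length (blacks A)
    bB = length (blacks B)
    lA = #labels A
    lB = #labels B
    cA = #closes A
    cB = #closes B
    K = Y invW + Y invB + Y bwPair

    swap : Q s + weigh Y ≡ Q t + weigh X
    swap = begin
      Q s + weigh Y                                  ≡⟨ weigh-+ (λ P → countPairs P s) Y ⟩
      weigh (λ P → countPairs P s + cross P B A)     ≡⟨ weigh-cong (λ P → countPairs-transpose P L A B M) ⟩
      weigh (λ P → countPairs P t + cross P A B)     ≡⟨ weigh-+ (λ P → countPairs P t) X ⟨
      Q t + weigh X                                  ∎
      where open ≡-Reasoning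

    inversions-W : X invW + Y invW ≡ wA * wB
    inversions-W = trans (cong₂ _+_ (cross-cong invW-viaKey A B) (cross-cong invW-viaKey B A))
      (inversions-cross whiteKey A B (mapMaybe-middle-disjoint whiteKey L A B M whites-unique))

    inversions-B : X invB + Y invB ≡ bA * bB
    inversions-B = trans (cong₂ _+_ (cross-cong invB-viaKey A B) (cross-cong invB-viaKey B A))
      (inversions-cross blackKey A B (mapMaybe-middle-disjoint blackKey L A B M blacks-unique))

    black-white : ∀ C D → cross bwPair C D ≡ length (blacks C) * length (whites D)
    black-white C D = trans (cross-product _ _ bwPair-split C D)
      (sym (cong₂ _*_ (length-mapMaybe blackKey C) (length-mapMaybe whiteKey D)))

    close-label : ∀ C D → cross clPair C D ≡ #closes C * #labels D
    close-label = cross-product isClose isLabel clPair-split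

    exact : Q t + 2 * (lA * lB) + cA * lB ≡ Q s + cB * lA + K * 4
    exact = begin
      Q t + 2 * (lA * lB) + cA * lB
        ≡⟨ cong₂ (λ a b → Q t + 2 * a + b)
             (cong₂ _*_ (#labels≡#whites+#blacks A) (#labels≡#whites+#blacks B)) (sym (close-label A B)) ⟩
      Q t + 2 * ((wA + bA) * (wB + bB)) + X clPair
        ≡⟨ cong (λ a → Q t + 2 * a + X clPair) (expand wA bA wB bB) ⟩
      Q t + 2 * (wA * wB + bA * bB + bA * wB + bB * wA) + X clPair
        ≡⟨ cong (λ a → Q t + 2 * a + X clPair)
             (cong₂ _+_ (cong₂ _+_ (cong₂ _+_ inversions-W inversions-B) (black-white A B)) (black-white B A)) ⟨
      Q t + 2 * (X invW + Y invW + (X invB + Y invB) + X bwPair + Y bwPair) + X clPair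
        ≡⟨ regroup (Q t) (X invW) (Y invW) (X invB) (Y invB) (X bwPair) (Y bwPair) (X clPair) ⟩
      Q t + weigh X + 2 * K
        ≡⟨ cong (_+ 2 * K) swap ⟨
      Q s + weigh Y + 2 * K
        ≡⟨ regroup′ (Q s) (Y invW) (Y invB) (Y bwPair) (Y clPair) ⟩
      Q s + Y clPair + K * 4
        ≡⟨ cong (λ a → Q s + a + K * 4) (close-label B A) ⟩
      Q s + cB * lA + K * 4 ∎
      where
      open ≡-Reasoning
      expand : ∀ w b w′ b′ → (w + b) * (w′ + b′) ≡ w * w′ + b * b′ + b * w′ + b′ * w
      expand = solve-∀
      regroup : ∀ q a a′ b b′ c c′ d →
        q + 2 * (a + a′ + (b + b′) + c + c′) + d ≡ q + (2 * (a + b + c) + d) + 2 * (a′ + b′ + c′)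
      regroup = solve-∀
      regroup′ : ∀ q a b c d → q + (2 * (a + b + c) + d) + 2 * (a + b + c) ≡ q + d + (a + b + c) * 4
      regroup′ = solve-∀

  -- Transpositions of blocks

  infix 4 _↝[_]_

  record _↝[_]_ (s : List (Tok n m)) (d : ℕ) (t : List (Tok n m)) : Set where
    field
      rearranges   : s ↭ t
      shifts-index : Admissible s → doubledIndex t + d ≡₄ doubledIndex s

  open _↝[_]_ public

  ↝-refl : ∀ {s} → s ↝[ 0 ] s
  ↝-refl {s} = record
    { rearranges = ↭-refl ; shifts-index = λ _ → mod4 (cong (_% 4) (+-identityʳ (doubledIndex s))) }

  ↝-trans : ∀ {s t u d e} → s ↝[ d ] t → t ↝[ e ] u → s ↝[ d + e ] u
  ↝-trans {s} {t} {u} {d} {e} s↝t t↝u = record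
    { rearranges   = ↭-trans (rearranges s↝t) (rearranges t↝u)
    ; shifts-index = λ adm → begin
        doubledIndex u + (d + e)  ≡⟨ regroup (doubledIndex u) d e ⟩
        doubledIndex u + e + d    ≈⟨ +-congʳ₄ d (shifts-index t↝u (Admissible-↭ (rearranges s↝t) adm)) ⟩
        doubledIndex t + d        ≈⟨ shifts-index s↝t adm ⟩
        doubledIndex s            ∎
    }
    where
    open ≡₄-Reasoning
    regroup : ∀ a b c → a + (b + c) ≡ a + c + b
    regroup = solve-∀

  ↝-sym : ∀ {s t} k → s ↝[ 2 * k ] t → t ↝[ 2 * k ] s
  ↝-sym k s↝t = record
    { rearranges   = ↭-sym (rearranges s↝t)
    ; shifts-index = λ adm →
        +2*-swap₄ k (≡₄-sym (shifts-index s↝t (Admissible-↭ (↭-sym (rearranges s↝t)) adm)))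
    }

  ↝-weaken : ∀ {s t d e} → (Admissible s → d ≡₄ e) → s ↝[ d ] t → s ↝[ e ] t
  ↝-weaken {s} {t} {d} {e} d≡e s↝t = record
    { rearranges   = rearranges s↝t
    ; shifts-index = λ adm → ≡₄-trans (+-cong₄ (mod4 refl) (≡₄-sym (d≡e adm))) (shifts-index s↝t adm)
    }

  transpose : ∀ L A B M e → #closes A * #labels B ≡ e + #closes B * #labels A →
              L ++ A ++ B ++ M ↝[ 2 * (#labels A * #labels B) + e ] L ++ B ++ A ++ M
  transpose L A B M e closes-balance = record
    { rearranges   = ↭.++⁺ˡ L (↭.shifts A B)
    ; shifts-index = λ adm → +-cancelʳ₄ (#closes B * #labels A)
        (subst (_≡₄ doubledIndex (L ++ A ++ B ++ M) + #closes B * #labels A) regroup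
               (doubledIndex-transpose L A B M adm))
    }
    where
    d = 2 * (#labels A * #labels B)
    regroup : doubledIndex (L ++ B ++ A ++ M) + d + #closes A * #labels B ≡
              doubledIndex (L ++ B ++ A ++ M) + (d + e) + #closes B * #labels A
    regroup = trans (cong (doubledIndex (L ++ B ++ A ++ M) + d +_) closes-balance)
                    (lemma (doubledIndex (L ++ B ++ A ++ M)) d e (#closes B * #labels A))
      where
      lemma : ∀ q d e c → q + d + (e + c) ≡ q + (d + e) + c
      lemma = solve-∀

  Balanced : List (Tok n m) → Set
  Balanced s = #closes s ≡ #labels s

  Balanced-++ : ∀ s t → Balanced s → Balanced t → Balanced (s ++ t)
  Balanced-++ s t bal-s bal-t = begin
    #closes (s ++ t)      ≡⟨ count-++ isClose s t ⟩
    #closes s + #closes t ≡⟨ cong₂ _+_ bal-s bal-t ⟩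
    #labels s + #labels t ≡⟨ count-++ isLabel s t ⟨
    #labels (s ++ t)      ∎
    where open ≡-Reasoning

  closes-after : ∀ s → Balanced s → #closes (s ++ [ close ]) ≡ suc (#labels (s ++ [ close ]))
  closes-after s bal = begin
    #closes (s ++ [ close ])      ≡⟨ count-++ isClose s [ close ] ⟩
    #closes s + 1                 ≡⟨ cong (_+ 1) bal ⟩
    #labels s + 1                 ≡⟨ +-comm (#labels s) 1 ⟩
    suc (#labels s)               ≡⟨ cong suc (#labels-close s) ⟨
    suc (#labels (s ++ [ close ])) ∎
    where open ≡-Reasoning

  Balanced-enclose : ∀ x s → T (isLabel x) → Balanced s → Balanced (x ∷ s ++ [ close ])
  Balanced-enclose (white _) s _ bal = closes-after s bal
  Balanced-enclose (black _) s _ bal = closes-after s bal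

  transpose-balanced : ∀ L A B M → Balanced A → Balanced B →
    L ++ A ++ B ++ M ↝[ 2 * (#labels A * #labels B) ] L ++ B ++ A ++ M
  transpose-balanced L A B M bal-A bal-B =
    subst (λ d → L ++ A ++ B ++ M ↝[ d ] L ++ B ++ A ++ M) (+-identityʳ _)
      (transpose L A B M 0 closes-balance)
    where
    closes-balance : #closes A * #labels B ≡ #closes B * #labels A
    closes-balance = begin
      #closes A * #labels B ≡⟨ cong (_* #labels B) bal-A ⟩
      #labels A * #labels B ≡⟨ *-comm (#labels A) (#labels B) ⟩
      #labels B * #labels A ≡⟨ cong (_* #labels A) bal-B ⟨
      #closes B * #labels A ∎
      where open ≡-Reasoning

  -- Codes of trees

  codeBs-++ : ∀ (xs ys : List (BT n m)) → codeBs (xs ++ ys) ≡ codeBs xs ++ codeBs ys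
  codeBs-++ []                ys = refl
  codeBs-++ (bn l ws ∷ xs) ys = trans (cong ((black l ∷ codeWs ws ++ [ close ]) ++_) (codeBs-++ xs ys))
    (sym (++-assoc (black l ∷ codeWs ws ++ [ close ]) (codeBs xs) (codeBs ys)))

  codeWs-++ : ∀ (xs ys : List (WT n m)) → codeWs (xs ++ ys) ≡ codeWs xs ++ codeWs ys
  codeWs-++ []       ys = refl
  codeWs-++ (x ∷ xs) ys =
    trans (cong (codeW x ++_) (codeWs-++ xs ys)) (sym (++-assoc (codeW x) (codeWs xs) (codeWs ys)))

  Balanced-codeW  : ∀ t  → Balanced (codeW t)
  Balanced-codeBs : ∀ bs → Balanced (codeBs bs)
  Balanced-codeWs : ∀ ws → Balanced (codeWs ws)
  Balanced-codeW (wn l cs) = Balanced-enclose (white l) (codeBs cs) _ (Balanced-codeBs cs)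
  Balanced-codeBs []             = refl
  Balanced-codeBs (bn l ws ∷ bs) = Balanced-++ (black l ∷ codeWs ws ++ [ close ]) (codeBs bs)
    (Balanced-enclose (black l) (codeWs ws) _ (Balanced-codeWs ws)) (Balanced-codeBs bs)
  Balanced-codeWs []       = refl
  Balanced-codeWs (w ∷ ws) = Balanced-++ (codeW w) (codeWs ws) (Balanced-codeW w) (Balanced-codeWs ws)

  whites-codeW  : ∀ t  → whites (codeW t)   ≡ whitesW t
  whites-codeBs : ∀ bs → whites (codeBs bs) ≡ whitesBs bs
  whites-codeWs : ∀ ws → whites (codeWs ws) ≡ whitesWs ws
  whites-codeW (wn l cs) = cong (l ∷_) (trans (whites-close (codeBs cs)) (whites-codeBs cs))
  whites-codeBs []             = refl
  whites-codeBs (bn l ws ∷ bs) = trans (whites-++ (black l ∷ codeWs ws ++ [ close ]) (codeBs bs))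
    (cong₂ _++_ (trans (whites-close (codeWs ws)) (whites-codeWs ws)) (whites-codeBs bs))
  whites-codeWs []       = refl
  whites-codeWs (w ∷ ws) =
    trans (whites-++ (codeW w) (codeWs ws)) (cong₂ _++_ (whites-codeW w) (whites-codeWs ws))

  blacks-codeW  : ∀ t  → blacks (codeW t)   ≡ blacksW t
  blacks-codeBs : ∀ bs → blacks (codeBs bs) ≡ blacksBs bs
  blacks-codeWs : ∀ ws → blacks (codeWs ws) ≡ blacksWs ws
  blacks-codeW (wn l cs) = trans (blacks-close (codeBs cs)) (blacks-codeBs cs)
  blacks-codeBs []             = refl
  blacks-codeBs (bn l ws ∷ bs) = trans (blacks-++ (black l ∷ codeWs ws ++ [ close ]) (codeBs bs))
    (cong₂ _++_ (cong (l ∷_) (trans (blacks-close (codeWs ws)) (blacks-codeWs ws))) (blacks-codeBs bs))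
  blacks-codeWs []       = refl
  blacks-codeWs (w ∷ ws) =
    trans (blacks-++ (codeW w) (codeWs ws)) (cong₂ _++_ (blacks-codeW w) (blacks-codeWs ws))

  labelled⇒admissible : 2 ∣ n + m → ∀ t → Labelled t → Admissible (codeW t)
  labelled⇒admissible even-size t (whites↭ , blacks↭) = record
    { whites-unique = Unique-resp-↭ (↭-sym whites-perm) (allFin⁺ n)
    ; blacks-unique = Unique-resp-↭ (↭-sym blacks-perm) (allFin⁺ m)
    ; labels-even   = subst (2 ∣_) (sym labels) even-size
    }
    where
    whites-perm : whites (codeW t) ↭ allFin n
    whites-perm = subst (_↭ allFin n) (sym (whites-codeW t)) whites↭
    blacks-perm : blacks (codeW t) ↭ allFin m
    blacks-perm = subst (_↭ allFin m) (sym (blacks-codeW t)) blacks↭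
    labels : #labels (codeW t) ≡ n + m
    labels = trans (#labels≡#whites+#blacks (codeW t))
      (cong₂ _+_ (trans (↭.↭-length whites-perm) (length-tabulate {n = n} id))
                 (trans (↭.↭-length blacks-perm) (length-tabulate {n = m} id)))

  -- Changes of root and elementary movements

  rotate-↝ : ∀ l c cs → codeW (wn l (c ∷ cs)) ↝[ 0 ] codeW (wn l (cs ++ [ c ]))
  rotate-↝ l c cs = ↝-weaken product-even
    (subst₂ (_↝[ 2 * (#labels C * #labels Cs) ]_) (sym source) (sym target)
      (transpose-balanced [ white l ] C Cs [ close ] (Balanced-codeBs [ c ]) (Balanced-codeBs cs)))
    where
    C  = codeBs [ c ]
    Cs = codeBs cs
    source : codeW (wn l (c ∷ cs)) ≡ [ white l ] ++ C ++ Cs ++ [ close ]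
    source = cong (white l ∷_) (trans (cong (_++ [ close ]) (codeBs-++ [ c ] cs)) (++-assoc C Cs [ close ]))
    target : codeW (wn l (cs ++ [ c ])) ≡ [ white l ] ++ Cs ++ C ++ [ close ]
    target = cong (white l ∷_) (trans (cong (_++ [ close ]) (codeBs-++ cs [ c ])) (++-assoc Cs C [ close ]))
    product-even : Admissible (codeW (wn l (c ∷ cs))) → 2 * (#labels C * #labels Cs) ≡₄ 0
    product-even adm =
      2∣1+m+n⇒2*[m*n]≡₄0 (#labels C) (#labels Cs) (subst (2 ∣_) labels (Admissible.labels-even adm))
      where
      labels : #labels (codeW (wn l (c ∷ cs))) ≡ 1 + #labels C + #labels Cs
      labels = trans (cong #labels source)
        (cong suc (trans (#labels-++ C (Cs ++ [ close ])) (cong (#labels C +_) (#labels-close Cs))))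

  descend-↝ : ∀ lr lb lw cs ws rest →
    codeW (wn lr (bn lb (wn lw cs ∷ ws) ∷ rest)) ↝[ 0 ] codeW (wn lw (bn lb (ws ++ [ wn lr rest ]) ∷ cs))
  descend-↝ lr lb lw cs ws rest = ↝-weaken total-shift
    (subst₂ (_↝[ shift ]_) (sym source) (sym target)
      (↝-trans τ₁ (↝-trans τ₂ (↝-trans τ₃ (↝-trans τ₄ (↝-sym k τ₅))))))
    where
    open MonoidSolver (++-monoid (Tok n m)) renaming (id to ε)
    r = [ white lr ]
    b = [ black lb ]
    w = [ white lw ]
    c = [ close ]
    K = codeBs cs
    W = codeWs ws
    R = codeBs rest
    k = #labels K
    p = #labels W
    q = #labels R

    -- The five block transpositions [r b][w], [r][b], [r K c][W], [K c c][R] and [c c][K]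
    -- (the last one performed backwards) turn S₀ into S₅.
    S₀ S₁ S₂ S₃ S₄ S₅ : List (Tok n m)
    S₀ = r ++ b ++ w ++ K ++ c ++ W ++ c ++ R ++ c
    S₁ = w ++ r ++ b ++ K ++ c ++ W ++ c ++ R ++ c
    S₂ = w ++ b ++ r ++ K ++ c ++ W ++ c ++ R ++ c
    S₃ = (w ++ b) ++ W ++ (r ++ K ++ c) ++ c ++ R ++ c
    S₄ = (w ++ b ++ W ++ r) ++ R ++ (K ++ c ++ c) ++ c
    S₅ = (w ++ b ++ W ++ r ++ R) ++ (c ++ c) ++ K ++ c

    τ₁ : S₀ ↝[ 4 ] S₁
    τ₁ = transpose [] (r ++ b) w (K ++ c ++ W ++ c ++ R ++ c) 0 refl
    τ₂ : S₁ ↝[ 2 ] S₂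
    τ₂ = transpose w r b (K ++ c ++ W ++ c ++ R ++ c) 0 refl
    τ₃ : S₂ ↝[ 2 * (#labels (r ++ K ++ c) * p) ] S₃
    τ₃ = subst (_↝[ 2 * (#labels (r ++ K ++ c) * p) ] S₃) (solve 7 (λ r b w c K W R →
           (w ⊕ b) ⊕ ((r ⊕ (K ⊕ c)) ⊕ (W ⊕ (c ⊕ (R ⊕ c)))) ⊜
           w ⊕ (b ⊕ (r ⊕ (K ⊕ (c ⊕ (W ⊕ (c ⊕ (R ⊕ c))))))))
           refl r b w c K W R)
         (transpose-balanced (w ++ b) (r ++ K ++ c) W (c ++ R ++ c)
           (Balanced-codeW (wn lr cs)) (Balanced-codeWs ws))
    closes₄ : #closes (K ++ c ++ c) * q ≡ 2 * q + #closes R * #labels (K ++ c ++ c)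
    closes₄ = begin
      #closes (K ++ c ++ c) * q          ≡⟨ cong (_* q) (count-++ isClose K (c ++ c)) ⟩
      (#closes K + 2) * q                ≡⟨ cong (λ a → (a + 2) * q) (Balanced-codeBs cs) ⟩
      (k + 2) * q                        ≡⟨ regroup k q ⟩
      2 * q + q * (k + 0)
        ≡⟨ cong₂ (λ a b → 2 * q + a * b) (Balanced-codeBs rest) (#labels-++ K (c ++ c)) ⟨
      2 * q + #closes R * #labels (K ++ c ++ c) ∎
      where
      open ≡-Reasoning
      regroup : ∀ k q → (k + 2) * q ≡ 2 * q + q * (k + 0)
      regroup = solve-∀
    τ₄ : S₃ ↝[ 2 * (#labels (K ++ c ++ c) * q) + 2 * q ] S₄
    τ₄ = subst (_↝[ 2 * (#labels (K ++ c ++ c) * q) + 2 * q ] S₄) (solve 7 (λ r b w c K W R →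
           (w ⊕ (b ⊕ (W ⊕ r))) ⊕ ((K ⊕ (c ⊕ c)) ⊕ (R ⊕ c)) ⊜
           (w ⊕ b) ⊕ (W ⊕ ((r ⊕ (K ⊕ c)) ⊕ (c ⊕ (R ⊕ c)))))
           refl r b w c K W R)
         (transpose (w ++ b ++ W ++ r) (K ++ c ++ c) R c (2 * q) closes₄)
    τ₅ : S₅ ↝[ 2 * k ] S₄
    τ₅ = subst (S₅ ↝[ 2 * k ]_) (solve 7 (λ r b w c K W R →
           (w ⊕ (b ⊕ (W ⊕ (r ⊕ R)))) ⊕ (K ⊕ ((c ⊕ c) ⊕ c)) ⊜
           (w ⊕ (b ⊕ (W ⊕ r))) ⊕ (R ⊕ ((K ⊕ (c ⊕ c)) ⊕ c)))
           refl r b w c K W R)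
         (transpose (w ++ b ++ W ++ r ++ R) (c ++ c) K c (2 * k)
           (sym (trans (cong (2 * k +_) (*-zeroʳ (#closes K))) (+-identityʳ (2 * k)))))
    source : codeW (wn lr (bn lb (wn lw cs ∷ ws) ∷ rest)) ≡ S₀
    source = solve 7 (λ r b w c K W R →
        r ⊕ (((b ⊕ (((w ⊕ (K ⊕ c)) ⊕ W) ⊕ c)) ⊕ R) ⊕ c) ⊜
        r ⊕ (b ⊕ (w ⊕ (K ⊕ (c ⊕ (W ⊕ (c ⊕ (R ⊕ c))))))))
      refl r b w c K W R
    target : codeW (wn lw (bn lb (ws ++ [ wn lr rest ]) ∷ cs)) ≡ S₅
    target = trans
      (cong (λ z → white lw ∷ ((black lb ∷ z ++ [ close ]) ++ K) ++ [ close ]) (codeWs-++ ws [ wn lr rest ]))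
      (solve 7 (λ r b w c K W R →
        w ⊕ (((b ⊕ ((W ⊕ ((r ⊕ (R ⊕ c)) ⊕ ε)) ⊕ c)) ⊕ K) ⊕ c) ⊜
        (w ⊕ (b ⊕ (W ⊕ (r ⊕ R)))) ⊕ ((c ⊕ c) ⊕ (K ⊕ c)))
      refl r b w c K W R)
    shift : ℕ
    shift = 4 + (2 + (2 * (#labels (r ++ K ++ c) * p) + ((2 * (#labels (K ++ c ++ c) * q) + 2 * q) + 2 * k)))
    labels : #labels (codeW (wn lr (bn lb (wn lw cs ∷ ws) ∷ rest))) ≡ 1 + (1 + k) + (1 + p + q)
    labels = begin
      #labels (codeW (wn lr (bn lb (wn lw cs ∷ ws) ∷ rest)))  ≡⟨ cong #labels source ⟩
      3 + #labels (K ++ c ++ W ++ c ++ R ++ c)               ≡⟨ cong (3 +_) (#labels-++ K _) ⟩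
      3 + (k + #labels (W ++ c ++ R ++ c))                   ≡⟨ cong (λ a → 3 + (k + a)) (#labels-++ W _) ⟩
      3 + (k + (p + #labels (R ++ c)))                       ≡⟨ cong (λ a → 3 + (k + (p + a))) (#labels-close R) ⟩
      3 + (k + (p + q))                                      ≡⟨ regroup′ k p q ⟩
      1 + (1 + k) + (1 + p + q)                              ∎
      where
      open ≡-Reasoning
      regroup′ : ∀ k p q → 3 + (k + (p + q)) ≡ 1 + (1 + k) + (1 + p + q)
      regroup′ = solve-∀
    total-shift : Admissible (codeW (wn lr (bn lb (wn lw cs ∷ ws) ∷ rest))) → shift ≡₄ 0
    total-shift adm = begin
      shift
        ≡⟨ cong₂ (λ a b → 4 + (2 + (2 * (a * p) + ((2 * (b * q) + 2 * q) + 2 * k))))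
             (cong suc (#labels-++ K c)) (#labels-++ K (c ++ c)) ⟩
      4 + (2 + (2 * ((1 + (k + 0)) * p) + ((2 * ((k + 0) * q) + 2 * q) + 2 * k)))
        ≡⟨ regroup k p q ⟩
      2 * ((1 + k) * (1 + p + q)) + 4
        ≈⟨ +-absorbʳ₄ (2 * ((1 + k) * (1 + p + q))) ∣-refl ⟩
      2 * ((1 + k) * (1 + p + q))
        ≈⟨ 2∣1+m+n⇒2*[m*n]≡₄0 (1 + k) (1 + p + q) (subst (2 ∣_) labels (Admissible.labels-even adm)) ⟩
      0 ∎
      where
      open ≡₄-Reasoning
      regroup : ∀ k p q →
        4 + (2 + (2 * ((1 + (k + 0)) * p) + ((2 * ((k + 0) * q) + 2 * q) + 2 * k))) ≡
        2 * ((1 + k) * (1 + p + q)) + 4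
      regroup = solve-∀

  reroot-↝ : ∀ {x y : WT n m} → Reroot x y → codeW x ↝[ 0 ] codeW y
  reroot-↝ (rotate l c cs)               = rotate-↝ l c cs
  reroot-↝ (descend lr lb lw cs ws rest) = descend-↝ lr lb lw cs ws rest

  ≈ᵀ-↝ : ∀ {x y : WT n m} → x ≈ᵀ y → codeW x ↝[ 0 ] codeW y
  ≈ᵀ-↝ ε                 = ↝-refl
  ≈ᵀ-↝ (fwd x→y ◅ y≈z)   = ↝-trans (reroot-↝ x→y) (≈ᵀ-↝ y≈z)
  ≈ᵀ-↝ (bwd y→x ◅ y≈z)   = ↝-trans (↝-sym 0 (reroot-↝ y→x)) (≈ᵀ-↝ y≈z)

  elemStep-↝ : ∀ {x y : WT n m} → ElemStep x y → codeW x ↝[ 2 ] codeW y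
  elemStep-↝ (black-leaf lr la lx lw cs ws rest) =
    ↝-weaken (λ _ → mod4 refl)
      (transpose [ white lr ] (black la ∷ close ∷ []) (black lx ∷ white lw ∷ []) _ 2 refl)
  elemStep-↝ (black-leaf-back lr la lx rest) =
    transpose [ white lr ] (black la ∷ close ∷ []) (black lx ∷ close ∷ []) _ 0 refl
  elemStep-↝ (white-leaf lw lb ws la ly ys rest) =
    subst₂ (_↝[ 2 ]_) (sym source) (sym target) (transpose L A B M 0 refl)
    where
    open MonoidSolver (++-monoid (Tok n m))
    W = codeWs ws
    Y = codeWs ys
    R = codeBs rest
    L = white lw ∷ black lb ∷ W
    A = white la ∷ close ∷ []
    B = close ∷ black ly ∷ []
    M = Y ++ close ∷ R ++ [ close ]
    source : codeW (wn lw (bn lb (ws ++ [ wn la [] ]) ∷ bn ly ys ∷ rest)) ≡ L ++ A ++ B ++ M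
    source = trans
      (cong (λ z → white lw ∷ ((black lb ∷ z ++ [ close ]) ++ (black ly ∷ Y ++ [ close ]) ++ R) ++ [ close ])
            (codeWs-++ ws [ wn la [] ]))
      (cong (white lw ∷_) (solve 7 (λ b W a c y Y R →
          ((b ⊕ ((W ⊕ (a ⊕ c)) ⊕ c)) ⊕ ((y ⊕ (Y ⊕ c)) ⊕ R)) ⊕ c ⊜
          b ⊕ (W ⊕ ((a ⊕ c) ⊕ ((c ⊕ y) ⊕ (Y ⊕ (c ⊕ (R ⊕ c)))))))
        refl [ black lb ] W [ white la ] [ close ] [ black ly ] Y R))
    target : codeW (wn lw (bn lb ws ∷ bn ly (wn la [] ∷ ys) ∷ rest)) ≡ L ++ B ++ A ++ M
    target = cong (white lw ∷_) (solve 7 (λ b W a c y Y R →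
          ((b ⊕ (W ⊕ c)) ⊕ ((y ⊕ (((a ⊕ c) ⊕ Y) ⊕ c)) ⊕ R)) ⊕ c ⊜
          b ⊕ (W ⊕ ((c ⊕ y) ⊕ ((a ⊕ c) ⊕ (Y ⊕ (c ⊕ (R ⊕ c)))))))
        refl [ black lb ] W [ white la ] [ close ] [ black ly ] Y R)
  elemStep-↝ (white-leaf-back lw lb ws la) =
    ↝-weaken odd-leaves (subst₂ (_↝[ 2 * (#labels W * 1) ]_) (sym source) (sym target)
      (transpose-balanced L W A M (Balanced-codeWs ws) refl))
    where
    open MonoidSolver (++-monoid (Tok n m)) renaming (id to ε)
    W = codeWs ws
    L = white lw ∷ black lb ∷ []
    A = white la ∷ close ∷ []
    M = close ∷ close ∷ []
    source : codeW (wn lw (bn lb (ws ++ [ wn la [] ]) ∷ [])) ≡ L ++ W ++ A ++ M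
    source = trans
      (cong (λ z → white lw ∷ ((black lb ∷ z ++ [ close ]) ++ []) ++ [ close ]) (codeWs-++ ws [ wn la [] ]))
      (cong (white lw ∷_) (solve 4 (λ b W a c →
          ((b ⊕ ((W ⊕ (a ⊕ c)) ⊕ c)) ⊕ ε) ⊕ c ⊜ b ⊕ (W ⊕ ((a ⊕ c) ⊕ (c ⊕ c))))
        refl [ black lb ] W [ white la ] [ close ]))
    target : codeW (wn lw (bn lb (wn la [] ∷ ws) ∷ [])) ≡ L ++ A ++ W ++ M
    target = cong (white lw ∷_) (solve 4 (λ b W a c →
          ((b ⊕ (((a ⊕ c) ⊕ W) ⊕ c)) ⊕ ε) ⊕ c ⊜ b ⊕ ((a ⊕ c) ⊕ (W ⊕ (c ⊕ c))))
        refl [ black lb ] W [ white la ] [ close ])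
    odd-leaves : Admissible (codeW (wn lw (bn lb (ws ++ [ wn la [] ]) ∷ []))) → 2 * (#labels W * 1) ≡₄ 2
    odd-leaves adm =
      subst (λ k → 2 * k ≡₄ 2) (sym (*-identityʳ (#labels W))) (2∣1+n⇒2*n≡₄2 (#labels W) odd-W)
      where
      even-total : 2 ∣ 2 + (#labels W + 1)
      even-total = subst (2 ∣_) (trans (cong #labels source) (cong (2 +_) (#labels-++ W (A ++ M))))
                     (Admissible.labels-even adm)
      odd-W : 2 ∣ 1 + #labels W
      odd-W = subst (2 ∣_) (+-comm (#labels W) 1) (∣m+n∣m⇒∣n even-total ∣-refl)

  elementary-↝ : ∀ {T T′ : WT n m} → Elementary T T′ → codeW T ↝[ 2 ] codeW T′
  elementary-↝ (r , r′ , T≈r , step , r′≈T′) =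
    ↝-trans (≈ᵀ-↝ T≈r) (↝-trans (either step) (≈ᵀ-↝ r′≈T′))
    where
    either : ElemStep r r′ ⊎ ElemStep r′ r → codeW r ↝[ 2 ] codeW r′
    either (inj₁ r→r′) = elemStep-↝ r→r′
    either (inj₂ r′→r) = ↝-sym 1 (elemStep-↝ r′→r)

  parity≡residue : ∀ (t : WT n m) → parity t ≡ (doubledIndex (codeW t) + ∣ n - m ∣ / 2) % 4 / 2
  parity≡residue t = sym $ begin
    (2 * s + d + e) % 4 / 2          ≡⟨ m%[n*o]/o≡m/o%n (2 * s + d + e) 2 2 ⟩
    (2 * s + d + e) / 2 % 2          ≡⟨ cong (λ z → z / 2 % 2) (regroup s d e) ⟩
    (d + e + s * 2) / 2 % 2          ≡⟨ cong (_% 2) (+-distrib-/-∣ʳ (d + e) (divides s refl)) ⟩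
    ((d + e) / 2 + s * 2 / 2) % 2    ≡⟨ cong (λ z → ((d + e) / 2 + z) % 2) (m*n/n≡m s 2) ⟩
    ((d + e) / 2 + s) % 2            ≡⟨ cong (_% 2) (+-comm ((d + e) / 2) s) ⟩
    (s + (d + e) / 2) % 2            ∎
    where
    open ≡-Reasoning
    s = countPairs invW (codeW t) + countPairs invB (codeW t) + countPairs bwPair (codeW t)
    d = countPairs clPair (codeW t)
    e = ∣ n - m ∣ / 2
    regroup : ∀ s d e → 2 * s + d + e ≡ d + e + s * 2
    regroup = solve-∀

  index-shift⇒parity≢ : ∀ (T T′ : WT n m) →
    doubledIndex (codeW T′) + 2 ≡₄ doubledIndex (codeW T) → parity T ≢ parity T′
  index-shift⇒parity≢ T T′ shift same-parity = m+2≡₄n⇒m%4/2≢n%4/2 (Q T′ + e) (Q T + e) shifted $ begin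
    (Q T′ + e) % 4 / 2  ≡⟨ parity≡residue T′ ⟨
    parity T′           ≡⟨ same-parity ⟨
    parity T            ≡⟨ parity≡residue T ⟩
    (Q T + e) % 4 / 2   ∎
    where
    open ≡-Reasoning
    Q = λ t → doubledIndex (codeW t)
    e = ∣ n - m ∣ / 2
    shifted : Q T′ + e + 2 ≡₄ Q T + e
    shifted = subst (_≡₄ Q T + e) (regroup (Q T′) 2 e) (+-congʳ₄ e shift)
      where
      regroup : ∀ a b c → a + b + c ≡ a + c + b
      regroup = solve-∀

theorem4p1 : ∀ (n m : ℕ) → 2 ∣ (n + m) →
    (T T' : WT n m) → Labelled T → Elementary T T' → parity T ≢ parity T'
theorem4p1 n m even-size T T′ labelled elementary =
  index-shift⇒parity≢ T T′
    (shifts-index (elementary-↝ elementary) (labelled⇒admissible even-size T labelled))
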